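{- Let $m\ge 1$, let $\mathbf d=(d_1,\dots,d_m)$ be positive integers and let $\boldsymbol\delta=(\delta_1,\dots,\delta_m)$ be positive integers such that $\gcd(\delta_i,d_i)=1$ for every $i$ and $\delta_i d_j\neq \delta_j d_i$ for all $i\neq j$. For $1\le i\le m$ define the integer vector $\mathbf d_i=(d_{i,1},\dots,d_{i,m})$ by $d_{i,i}=d_i$ and $d_{i,j}=\delta_i d_j-\delta_j d_i$ for $j\neq i$. Then for every nonnegative integer $\sigma$ and every nonnegative integer $s$, $$W(s,\mathbf d)=\sum_{i=1}^m W(s\delta_i+\sigma d_i,\ \mathbf d_i).$$
   Context: For positive integers $\mathbf e=(e_1,\dots,e_m)$ and an integer $n$, $W(n,\mathbf e)$ is the number of nonnegative integer solutions $(x_1,\dots,x_m)$ of $n=\sum_i e_i x_i$ (so $W(n,\mathbf e)=0$ for $n<0$); equivalently $\prod_{i=1}^m (1-t^{e_i})^{ -1}=\sum_{n\ge0}W(n,\mathbf e)t^n$. For a vector $\mathbf e$ of nonzero integers some of which are negative, say $e_{j_1},\dots,e_{j_K}<0$, one sets $W(n,\mathbf e)=(-1)^K\,W\big(n+\sum_{k=1}^K e_{j_k},\ |\mathbf e|\big)$ where $|\mathbf e|=(|e_1|,\dots,|e_m|)$ (this corresponds to expanding $(1-t^{ -a})^{ -1}=-t^a(1-t^a)^{ -1}$). Under the hypotheses all $d_{i,j}$ are nonzero. -}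

module Defs where

open import Data.Nat as ℕ using (ℕ; zero; suc; _∸_; _≤?_)
open import Data.Integer as ℤ using (ℤ; +_; -[1+_]; ∣_∣; _<?_)
open import Data.List using (List; []; _∷_; map; upTo; foldr; length; filter)
open import Data.Fin using (Fin)
open import Data.Fin.Properties using () renaming (_≟_ to _≟ᶠ_)
open import Data.Vec.Functional using (Vector; toList)
open import Relation.Nullary using (yes; no)

-- W(n, e) for a vector e of positive integers: the number of nonnegative
-- integer solutions (x₁,…,xₘ) of n = Σ eᵢ xᵢ, counted by recursion on the
-- first coordinate: x₁ ranges over 0..n (only those with e₁x₁ ≤ n contribute).
Wpos : ℕ → List ℕ → ℕ
Wpos zero    []       = 1
Wpos (suc _) []       = 0
Wpos n       (e ∷ es) = foldr ℕ._+_ 0 (map term (upTo (suc n)))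
  where
  term : ℕ → ℕ
  term x with e ℕ.* x ≤? n
  ... | yes _ = Wpos (n ∸ e ℕ.* x) es
  ... | no  _ = 0

-- W(n, e) for a vector of (nonzero) integers; for positive entries with n < 0 it is 0.
-- W(n, e) = (-1)^K W(n + Σ_{negative e_j} e_j, |e|), with K the number of negative entries.

open import Data.Bool using (Bool; true; false)

negEntries : List ℤ → List ℤ
negEntries = filter (λ x → x <? + 0)

W : ℤ → List ℤ → ℤ
W n e with n ℤ.+ foldr ℤ._+_ (+ 0) (negEntries e)
... | -[1+ _ ] = + 0
... | + k      = (ℤ.- (+ 1)) ℤ.^ length (negEntries e) ℤ.* (+ Wpos k (map ∣_∣ e))

sumFin : ∀ {m} → (Fin m → ℤ) → ℤ
sumFin f = foldr ℤ._+_ (+ 0) (toList f)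

dVec : ∀ {m} → (d δ : Fin m → ℕ) → Fin m → Vector ℤ m
dVec d δ i j with i ≟ᶠ j
... | yes _ = + d i
... | no  _ = + (δ i ℕ.* d j) ℤ.- + (δ j ℕ.* d i)

-- W(n, e) is a signed count of the points y ∈ ℤᵐ with e·y = n, each weighted by ∏ⱼ w(eⱼ, yⱼ), where
-- w(e, y) = [y ≥ 0] for e > 0 and w(e, y) = -[y < 0] for e < 0; every contributing point lies in a
-- box, so W is a finite box sum.
-- In the i-th term on the right fix yⱼ for j ≠ i. Since gcd(δᵢ, dᵢ) = 1, the equation dᵢ·y = sδᵢ + σdᵢ
-- has a solution yᵢ exactly when d·x = s has a solution xᵢ, where x agrees with y off i, and then
-- yᵢ = σ + δ·x. So the i-th term counts the x with d·x = s, weighted by [σ + δ·x ≥ 0] ∏_{j≠i} w(d_{i,j}, xⱼ).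
-- Ordering the indices by i ≺ j ⇔ d_{i,j} < 0 (a strict total order, as no d_{i,j} vanishes), the sum
-- over i of these products telescopes to ∏ⱼ [xⱼ ≥ 0] - ∏ⱼ ([xⱼ ≥ 0] - 1). On d·x = s ≥ 0 some xⱼ ≥ 0,
-- so the second product vanishes, and the first is nonzero only if all xⱼ ≥ 0, in which case also
-- σ + δ·x ≥ 0; what remains is the count W(s, d).

module Submission where

-- Kept in its own module because it uses ℤ's _+_ and _*_, while the statement below uses ℕ's.
module Proof where

  open import Defs
  open import Data.Nat as ℕ using (ℕ; zero; suc; _∸_; z≤n; s≤s)
  import Data.Nat.Properties as ℕ
  import Data.Nat.Tactic.RingSolver as ℕ
  import Data.Nat.Coprimality as ℕ
  open import Data.Nat.Coprimality using (Coprime)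
  open import Data.Nat.GCD using (gcd)
  open import Data.Integer as ℤ
    using (ℤ; +_; -[1+_]; _+_; _*_; -_; _-_; ∣_∣; _≤_; _<_; +≤+; -≤+; -≤-; +<+; -<+; nonNegative)
  open import Data.Integer.Properties
  open import Data.Integer.Tactic.RingSolver using (solve-∀)
  open import Data.Integer.Divisibility.Signed using (divides; _∣?_; ∣ᵤ⇒∣; ∣⇒∣ᵤ)
  import Data.Integer.Coprimality as ℤ
  open import Data.Fin as Fin using (Fin; zero; suc; toℕ; fromℕ<; punchIn)
  import Data.Fin.Properties as Fin
  open import Data.Vec using (Vec; []; _∷_; lookup; insertAt)
  open import Data.Vec.Properties using (insertAt-lookup; insertAt-punchIn)
  open import Data.Vec.Functional using (toList)
  open import Data.List using (List; []; _∷_; map; foldr; length; applyUpTo; upTo)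
  open import Data.List.Properties using (map-cong)
  open import Data.Product using (∃; _×_; _,_; proj₁; proj₂)
  open import Data.Sum using (_⊎_; inj₁; inj₂)
  open import Algebra.Bundles using (AbelianGroup)
  open import Function using (_∘_)
  open import Level using (0ℓ)
  open import Relation.Binary.Core using (Rel)
  open import Relation.Binary.Definitions using (Transitive; tri<; tri≈; tri>)
  open import Relation.Nullary using (yes; no; contradiction)
  open import Relation.Binary.PropositionalEquality
  open import Algebra.Properties.Semiring.Sum +-*-semiring as Sum
    using (sum; sum-cong-≗; sum-remove; sum-replicate-zero; *-distribˡ-sum)
  open import Algebra.Properties.Semiring.Sum ℕ.+-*-semiring
    using () renaming (sum to sumℕ; sum-remove to sumℕ-remove)
  open import Algebra.Properties.CommutativeSemigroup +-commutativeSemigroup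
    using () renaming (interchange to +-interchange)
  open import Algebra.Properties.CommutativeSemigroup *-commutativeSemigroup
    using () renaming (x∙yz≈y∙xz to x*[y*z]≡y*[x*z])
  open import Algebra.Properties.Group (AbelianGroup.group +-0-abelianGroup)
    using () renaming (∙-cancelʳ to +-cancelʳ-≡)
  open import Algebra.Properties.CommutativeMonoid.Sum *-1-commutativeMonoid
    using () renaming (sum to prod; sum-remove to prod-remove; sum-cong-≗ to prod-cong)

  -- Finite sums and products over Fin

  -- Opaque: unfolded at length suc n, a sum with a yet unknown summand would block unification.
  opaque
    ∑ : ∀ {n} → (Fin n → ℤ) → ℤ
    ∑ = sum

    ∏ : ∀ {n} → (Fin n → ℤ) → ℤ
    ∏ = prod

  opaque
    unfolding ∑ ∏

    ∑-empty : ∀ (f : Fin 0 → ℤ) → ∑ f ≡ + 0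
    ∑-empty f = refl

    ∑-suc : ∀ {n} (f : Fin (suc n) → ℤ) → ∑ f ≡ f zero + ∑ (f ∘ suc)
    ∑-suc f = refl

    ∑-cong : ∀ {n} {f g : Fin n → ℤ} → (∀ i → f i ≡ g i) → ∑ f ≡ ∑ g
    ∑-cong = sum-cong-≗

    ∑-zero : ∀ {n} {f : Fin n → ℤ} → (∀ i → f i ≡ + 0) → ∑ f ≡ + 0
    ∑-zero {n} f≗0 = trans (sum-cong-≗ f≗0) (sum-replicate-zero n)

    ∑-distrib-+ : ∀ {n} (f g : Fin n → ℤ) → ∑ (λ i → f i + g i) ≡ ∑ f + ∑ g
    ∑-distrib-+ = Sum.∑-distrib-+

    ∑-comm : ∀ {m n} (F : Fin m → Fin n → ℤ) → ∑ (λ i → ∑ (F i)) ≡ ∑ (λ j → ∑ (λ i → F i j))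
    ∑-comm = Sum.∑-comm

    ∑-remove : ∀ {n} (i : Fin (suc n)) (f : Fin (suc n) → ℤ) → ∑ f ≡ f i + ∑ (f ∘ punchIn i)
    ∑-remove i f = sum-remove f

    *-distribˡ-∑ : ∀ {n} c (f : Fin n → ℤ) → c * ∑ f ≡ ∑ (λ i → c * f i)
    *-distribˡ-∑ = *-distribˡ-sum

    ∏-empty : ∀ (f : Fin 0 → ℤ) → ∏ f ≡ + 1
    ∏-empty f = refl

    ∏-suc : ∀ {n} (f : Fin (suc n) → ℤ) → ∏ f ≡ f zero * ∏ (f ∘ suc)
    ∏-suc f = refl

    ∏-cong : ∀ {n} {f g : Fin n → ℤ} → (∀ i → f i ≡ g i) → ∏ f ≡ ∏ g
    ∏-cong = prod-cong

    ∏-remove : ∀ {n} (i : Fin (suc n)) (f : Fin (suc n) → ℤ) → ∏ f ≡ f i * ∏ (f ∘ punchIn i)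
    ∏-remove i f = prod-remove f

    sumFin≡∑ : ∀ {n} (f : Fin n → ℤ) → sumFin f ≡ ∑ f
    sumFin≡∑ {zero}  f = refl
    sumFin≡∑ {suc n} f = cong (_+_ (f zero)) (sumFin≡∑ (f ∘ suc))

  ∏-≡0 : ∀ {n} {f : Fin (suc n) → ℤ} j → f j ≡ + 0 → ∏ f ≡ + 0
  ∏-≡0 {f = f} j fj≡0 = trans (∏-remove j f) (cong (_* ∏ (f ∘ punchIn j)) fj≡0)

  ∏≢0⇒≢0 : ∀ {n} (f : Fin n → ℤ) → ∏ f ≢ + 0 → ∀ j → f j ≢ + 0
  ∏≢0⇒≢0 {suc n} f ∏≢0 j fj≡0 = ∏≢0 (∏-≡0 j fj≡0)

  ∑-nonneg : ∀ {n} (f : Fin n → ℤ) → (∀ i → + 0 ≤ f i) → + 0 ≤ ∑ f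
  ∑-nonneg {zero}  f _   = ≤-reflexive (sym (∑-empty f))
  ∑-nonneg {suc n} f 0≤f =
    subst (+ 0 ≤_) (sym (∑-suc f)) (+-mono-≤ (0≤f zero) (∑-nonneg (f ∘ suc) (0≤f ∘ suc)))

  ∑-nonpos : ∀ {n} (f : Fin n → ℤ) → (∀ i → f i ≤ + 0) → ∑ f ≤ + 0
  ∑-nonpos {zero}  f _   = ≤-reflexive (∑-empty f)
  ∑-nonpos {suc n} f f≤0 =
    subst (_≤ + 0) (sym (∑-suc f)) (+-mono-≤ (f≤0 zero) (∑-nonpos (f ∘ suc) (f≤0 ∘ suc)))

  ∑-neg : ∀ {n} (f : Fin (suc n) → ℤ) → (∀ i → f i < + 0) → ∑ f < + 0
  ∑-neg f f<0 =
    subst (_< + 0) (sym (∑-suc f)) (+-mono-<-≤ (f<0 zero) (∑-nonpos (f ∘ suc) (<⇒≤ ∘ f<0 ∘ suc)))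

  ∑-linear : ∀ {n} α β (f g : Fin n → ℤ) → ∑ (λ j → α * f j - β * g j) ≡ α * ∑ f - β * ∑ g
  ∑-linear α β f g = begin
    ∑ (λ j → α * f j - β * g j)            ≡⟨ ∑-cong (λ j → cong (_+_ (α * f j)) (neg-distribˡ-* β (g j))) ⟩
    ∑ (λ j → α * f j + - β * g j)          ≡⟨ ∑-distrib-+ (λ j → α * f j) (λ j → - β * g j) ⟩
    ∑ (λ j → α * f j) + ∑ (λ j → - β * g j) ≡⟨ cong₂ _+_ (*-distribˡ-∑ α f) (*-distribˡ-∑ (- β) g) ⟨
    α * ∑ f + - β * ∑ g                     ≡⟨ cong (_+_ (α * ∑ f)) (neg-distribˡ-* β (∑ g)) ⟨
    α * ∑ f - β * ∑ g                       ∎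
    where open ≡-Reasoning

  ∑-insertAt : ∀ {n} (g : Fin (suc n) → ℤ → ℤ) (y : Vec ℤ n) i t →
    ∑ (λ j → g j (lookup (insertAt y i t) j)) ≡ g i t + ∑ (λ j → g (punchIn i j) (lookup y j))
  ∑-insertAt g y i t = trans (∑-remove i _)
    (cong₂ _+_ (cong (g i) (insertAt-lookup y i t)) (∑-cong (λ j → cong (g (punchIn i j)) (insertAt-punchIn y i t j))))

  ∏-insertAt : ∀ {n} (g : Fin (suc n) → ℤ → ℤ) (y : Vec ℤ n) i t →
    ∏ (λ j → g j (lookup (insertAt y i t) j)) ≡ g i t * ∏ (λ j → g (punchIn i j) (lookup y j))
  ∏-insertAt g y i t = trans (∏-remove i _)
    (cong₂ _*_ (cong (g i) (insertAt-lookup y i t)) (∏-cong (λ j → cong (g (punchIn i j)) (insertAt-punchIn y i t j))))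

  ∣∑∣≤K∣∑∣ : ∀ {n} K (f g : Fin n → ℤ) → (∀ j → ∣ f j ∣ ℕ.≤ K ℕ.* ∣ g j ∣) →
    (∀ j → + 0 ≤ g j) →
    ∣ ∑ f ∣ ℕ.≤ K ℕ.* ∣ ∑ g ∣
  ∣∑∣≤K∣∑∣ {zero}  K f g _ _ = subst (λ x → ∣ x ∣ ℕ.≤ _) (sym (∑-empty f)) z≤n
  ∣∑∣≤K∣∑∣ {suc n} K f g f≤Kg 0≤g = begin
    ∣ ∑ f ∣                                    ≡⟨ cong ∣_∣ (∑-suc f) ⟩
    ∣ f zero + ∑ (f ∘ suc) ∣                   ≤⟨ ∣i+j∣≤∣i∣+∣j∣ (f zero) _ ⟩
    ∣ f zero ∣ ℕ.+ ∣ ∑ (f ∘ suc) ∣             ≤⟨ ℕ.+-mono-≤ (f≤Kg zero) tail-≤ ⟩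
    K ℕ.* ∣ g zero ∣ ℕ.+ K ℕ.* ∣ ∑ (g ∘ suc) ∣ ≡⟨ ℕ.*-distribˡ-+ K _ _ ⟨
    K ℕ.* (∣ g zero ∣ ℕ.+ ∣ ∑ (g ∘ suc) ∣)     ≡⟨ cong (K ℕ.*_) ∣g₀+∑g∣≡ ⟨
    K ℕ.* ∣ g zero + ∑ (g ∘ suc) ∣             ≡⟨ cong (λ x → K ℕ.* ∣ x ∣) (∑-suc g) ⟨
    K ℕ.* ∣ ∑ g ∣                              ∎
    where
    open ℕ.≤-Reasoning
    tail-≤ : ∣ ∑ (f ∘ suc) ∣ ℕ.≤ K ℕ.* ∣ ∑ (g ∘ suc) ∣
    tail-≤ = ∣∑∣≤K∣∑∣ K (f ∘ suc) (g ∘ suc) (f≤Kg ∘ suc) (0≤g ∘ suc)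
    ∣i+j∣≡∣i∣+∣j∣ : ∀ {i j} → + 0 ≤ i → + 0 ≤ j → ∣ i + j ∣ ≡ ∣ i ∣ ℕ.+ ∣ j ∣
    ∣i+j∣≡∣i∣+∣j∣ (+≤+ _) (+≤+ _) = refl
    ∣g₀+∑g∣≡ : ∣ g zero + ∑ (g ∘ suc) ∣ ≡ ∣ g zero ∣ ℕ.+ ∣ ∑ (g ∘ suc) ∣
    ∣g₀+∑g∣≡ = ∣i+j∣≡∣i∣+∣j∣ (0≤g zero) (∑-nonneg (g ∘ suc) (0≤g ∘ suc))

  ∣c*y∣≤K∣e*y∣ : ∀ {K} c e y → ∣ c ∣ ℕ.≤ K → e ≢ + 0 → ∣ c * y ∣ ℕ.≤ K ℕ.* ∣ e * y ∣
  ∣c*y∣≤K∣e*y∣ {K} c e y ∣c∣≤K e≢0 = begin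
    ∣ c * y ∣               ≡⟨ abs-* c y ⟩
    ∣ c ∣ ℕ.* ∣ y ∣         ≤⟨ ℕ.*-monoˡ-≤ ∣ y ∣ ∣c∣≤K ⟩
    K ℕ.* ∣ y ∣             ≤⟨ ℕ.*-monoʳ-≤ K (ℕ.m≤n*m ∣ y ∣ ∣ e ∣ {{∣e∣≢0}}) ⟩
    K ℕ.* (∣ e ∣ ℕ.* ∣ y ∣) ≡⟨ cong (K ℕ.*_) (abs-* e y) ⟨
    K ℕ.* ∣ e * y ∣         ∎
    where
    open ℕ.≤-Reasoning
    ∣e∣≢0 : ℕ.NonZero ∣ e ∣
    ∣e∣≢0 = ℕ.≢-nonZero (e≢0 ∘ ∣i∣≡0⇒i≡0)

  ≤-sumℕ : ∀ {n} (f : Fin n → ℕ) i → f i ℕ.≤ sumℕ f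
  ≤-sumℕ {suc n} f i = ℕ.≤-trans (ℕ.m≤m+n (f i) _) (ℕ.≤-reflexive (sym (sumℕ-remove {i = i} f)))

  -- Sums over an integer interval and over a box

  rangeIndex : ℤ → ℕ
  rangeIndex (+ n)    = n
  rangeIndex -[1+ n ] = n

  rangeIndex-≤ : ∀ {B t} → -[1+ B ] ≤ t → t ≤ + B → rangeIndex t ℕ.≤ B
  rangeIndex-≤ (-≤- n≤B) _         = n≤B
  rangeIndex-≤ -≤+       (+≤+ n≤B) = n≤B

  rangePair-at : ∀ (f : ℤ → ℤ) t₀ {n} → n ≡ rangeIndex t₀ → (∀ t → t ≢ t₀ → f t ≡ + 0) →
    f -[1+ n ] + f (+ n) ≡ f t₀
  rangePair-at f (+ m)    refl f≗0 = trans (cong (_+ f (+ m)) (f≗0 _ (λ ()))) (+-identityˡ _)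
  rangePair-at f -[1+ m ] refl f≗0 = trans (cong (_+_ (f -[1+ m ])) (f≗0 _ (λ ()))) (+-identityʳ _)

  pairSum : ∀ B → (ℤ → ℤ) → Fin (suc B) → ℤ
  pairSum B f k = f -[1+ toℕ k ] + f (+ toℕ k)

  opaque
    rangeSum : ℕ → (ℤ → ℤ) → ℤ
    rangeSum B f = ∑ (pairSum B f)

  opaque
    unfolding rangeSum

    rangeSum-cong : ∀ B {f g : ℤ → ℤ} → (∀ t → f t ≡ g t) → rangeSum B f ≡ rangeSum B g
    rangeSum-cong B f≗g = ∑-cong (λ k → cong₂ _+_ (f≗g _) (f≗g _))

    rangeSum-zero : ∀ B {f : ℤ → ℤ} → (∀ t → f t ≡ + 0) → rangeSum B f ≡ + 0
    rangeSum-zero B f≗0 = ∑-zero (λ k → cong₂ _+_ (f≗0 _) (f≗0 _))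

    rangeSum-distrib-+ : ∀ B (f g : ℤ → ℤ) → rangeSum B (λ t → f t + g t) ≡ rangeSum B f + rangeSum B g
    rangeSum-distrib-+ B f g =
      trans (∑-cong (λ k → +-interchange (f -[1+ toℕ k ]) (g -[1+ toℕ k ]) (f (+ toℕ k)) (g (+ toℕ k))))
            (∑-distrib-+ (pairSum B f) (pairSum B g))

    rangeSum-*ˡ : ∀ B c (f : ℤ → ℤ) → rangeSum B (λ t → c * f t) ≡ c * rangeSum B f
    rangeSum-*ˡ B c f = trans (∑-cong (λ k → sym (*-distribˡ-+ c _ _))) (sym (*-distribˡ-∑ c (pairSum B f)))

    ∑-rangeSum-comm : ∀ {n} B (F : Fin n → ℤ → ℤ) →
      ∑ (λ i → rangeSum B (F i)) ≡ rangeSum B (λ t → ∑ (λ i → F i t))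
    ∑-rangeSum-comm B F =
      trans (∑-comm (λ i → pairSum B (F i)))
            (∑-cong (λ k → ∑-distrib-+ (λ i → F i -[1+ toℕ k ]) (λ i → F i (+ toℕ k))))

    rangeSum-comm : ∀ B (G : ℤ → ℤ → ℤ) →
      rangeSum B (λ s → rangeSum B (G s)) ≡ rangeSum B (λ t → rangeSum B (λ s → G s t))
    rangeSum-comm B G =
      trans (∑-cong (λ k → sym (rangeSum-distrib-+ B (G -[1+ toℕ k ]) (G (+ toℕ k)))))
            (∑-rangeSum-comm B (λ k t → G -[1+ toℕ k ] t + G (+ toℕ k) t))

    rangeSum-nonneg : ∀ B {f : ℤ → ℤ} → (∀ n → f -[1+ n ] ≡ + 0) →
      rangeSum B f ≡ ∑ {suc B} (λ k → f (+ toℕ k))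
    rangeSum-nonneg B {f} f<0≡0 =
      ∑-cong (λ k → trans (cong (_+ f (+ toℕ k)) (f<0≡0 _)) (+-identityˡ _))

    rangeSum-neg : ∀ B {f : ℤ → ℤ} → (∀ n → f (+ n) ≡ + 0) →
      rangeSum B f ≡ ∑ {suc B} (λ k → f -[1+ toℕ k ])
    rangeSum-neg B {f} f≥0≡0 =
      ∑-cong (λ k → trans (cong (_+_ (f -[1+ toℕ k ])) (f≥0≡0 _)) (+-identityʳ _))

    rangeSum-single : ∀ B {f : ℤ → ℤ} {t₀} → -[1+ B ] ≤ t₀ → t₀ ≤ + B →
      (∀ t → t ≢ t₀ → f t ≡ + 0) → rangeSum B f ≡ f t₀
    rangeSum-single B {f} {t₀} lo hi f≗0 = begin
      ∑ (pairSum B f)                                 ≡⟨ ∑-remove k₀ (pairSum B f) ⟩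
      pairSum B f k₀ + ∑ (pairSum B f ∘ punchIn k₀)
        ≡⟨ cong₂ _+_ (rangePair-at f t₀ (Fin.toℕ-fromℕ< _) f≗0) (∑-zero pair-away) ⟩
      f t₀ + + 0                                      ≡⟨ +-identityʳ _ ⟩
      f t₀                                            ∎
      where
      open ≡-Reasoning
      k₀ : Fin (suc B)
      k₀ = fromℕ< (s≤s (rangeIndex-≤ lo hi))
      pair-away : ∀ j → pairSum B f (punchIn k₀ j) ≡ + 0
      pair-away j = cong₂ _+_ (f≗0 _ (away ∘ cong rangeIndex)) (f≗0 _ (away ∘ cong rangeIndex))
        where
        away : toℕ (punchIn k₀ j) ≢ rangeIndex t₀
        away eq = Fin.punchInᵢ≢i k₀ j (Fin.toℕ-injective (trans eq (sym (Fin.toℕ-fromℕ< _))))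

  ∣t∣≤B⇒inRange : ∀ {B} t → ∣ t ∣ ℕ.≤ B → -[1+ B ] ≤ t × t ≤ + B
  ∣t∣≤B⇒inRange (+ n)    n≤B = -≤+ , +≤+ n≤B
  ∣t∣≤B⇒inRange -[1+ n ] n<B = -≤- (ℕ.<⇒≤ n<B) , -≤+

  boxSum : ℕ → ∀ k → (Vec ℤ k → ℤ) → ℤ
  boxSum B zero    f = f []
  boxSum B (suc k) f = rangeSum B (λ t → boxSum B k (λ y → f (t ∷ y)))

  boxSum-cong : ∀ B k {f g : Vec ℤ k → ℤ} → (∀ y → f y ≡ g y) → boxSum B k f ≡ boxSum B k g
  boxSum-cong B zero    f≗g = f≗g []
  boxSum-cong B (suc k) f≗g = rangeSum-cong B (λ t → boxSum-cong B k (λ y → f≗g (t ∷ y)))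

  boxSum-zero : ∀ B k {f : Vec ℤ k → ℤ} → (∀ y → f y ≡ + 0) → boxSum B k f ≡ + 0
  boxSum-zero B zero    f≗0 = f≗0 []
  boxSum-zero B (suc k) f≗0 = rangeSum-zero B (λ t → boxSum-zero B k (λ y → f≗0 (t ∷ y)))

  boxSum-*ˡ : ∀ B k c (f : Vec ℤ k → ℤ) → boxSum B k (λ y → c * f y) ≡ c * boxSum B k f
  boxSum-*ˡ B zero    c f = refl
  boxSum-*ˡ B (suc k) c f =
    trans (rangeSum-cong B (λ t → boxSum-*ˡ B k c (λ y → f (t ∷ y)))) (rangeSum-*ˡ B c _)

  ∑-boxSum-comm : ∀ {n} B k (F : Fin n → Vec ℤ k → ℤ) →
    ∑ (λ i → boxSum B k (F i)) ≡ boxSum B k (λ y → ∑ (λ i → F i y))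
  ∑-boxSum-comm B zero    F = refl
  ∑-boxSum-comm B (suc k) F =
    trans (∑-rangeSum-comm B (λ i t → boxSum B k (λ y → F i (t ∷ y))))
          (rangeSum-cong B (λ t → ∑-boxSum-comm B k (λ i y → F i (t ∷ y))))

  rangeSum-boxSum-comm : ∀ B k (F : ℤ → Vec ℤ k → ℤ) →
    rangeSum B (λ t → boxSum B k (F t)) ≡ boxSum B k (λ y → rangeSum B (λ t → F t y))
  rangeSum-boxSum-comm B zero    F = refl
  rangeSum-boxSum-comm B (suc k) F =
    trans (rangeSum-comm B _) (rangeSum-cong B (λ a → rangeSum-boxSum-comm B k (λ t y → F t (a ∷ y))))

  boxSum-insertAt : ∀ B k (i : Fin (suc k)) (f : Vec ℤ (suc k) → ℤ) →
    boxSum B (suc k) f ≡ boxSum B k (λ y → rangeSum B (λ t → f (insertAt y i t)))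
  boxSum-insertAt B k       zero    f = rangeSum-boxSum-comm B k (λ t y → f (t ∷ y))
  boxSum-insertAt B (suc k) (suc i) f = rangeSum-cong B (λ a → boxSum-insertAt B k i (λ y → f (a ∷ y)))

  -- Indicators and weights

  opaque
    𝟙[_≡_] : ℤ → ℤ → ℤ
    𝟙[ a ≡ b ] with a ≟ b
    ... | yes _ = + 1
    ... | no  _ = + 0

    𝟙-≡ : ∀ {a b} → a ≡ b → 𝟙[ a ≡ b ] ≡ + 1
    𝟙-≡ {a} {b} a≡b with a ≟ b
    ... | yes _   = refl
    ... | no  a≢b = contradiction a≡b a≢b

    𝟙-≢ : ∀ {a b} → a ≢ b → 𝟙[ a ≡ b ] ≡ + 0
    𝟙-≢ {a} {b} a≢b with a ≟ b
    ... | yes a≡b = contradiction a≡b a≢b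
    ... | no  _   = refl

    𝟙-*-≢ : ∀ {a b} x → (a ≡ b → x ≡ + 0) → 𝟙[ a ≡ b ] * x ≡ + 0
    𝟙-*-≢ {a} {b} x a≡b⇒x≡0 with a ≟ b
    ... | yes a≡b = trans (*-identityˡ x) (a≡b⇒x≡0 a≡b)
    ... | no  _   = refl

    𝟙-*-cong : ∀ {a b x y} → (a ≡ b → x ≡ y) → 𝟙[ a ≡ b ] * x ≡ 𝟙[ a ≡ b ] * y
    𝟙-*-cong {a} {b} a≡b⇒x≡y with a ≟ b
    ... | yes a≡b = cong (+ 1 *_) (a≡b⇒x≡y a≡b)
    ... | no  _   = refl

    𝟙-cong-⇔ : ∀ {a b c d} → (a ≡ b → c ≡ d) → (c ≡ d → a ≡ b) → 𝟙[ a ≡ b ] ≡ 𝟙[ c ≡ d ]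
    𝟙-cong-⇔ {a} {b} {c} {d} to from with a ≟ b | c ≟ d
    ... | yes _   | yes _   = refl
    ... | yes a≡b | no  c≢d = contradiction (to a≡b) c≢d
    ... | no  a≢b | yes c≡d = contradiction (from c≡d) a≢b
    ... | no  _   | no  _   = refl

  heaviside : ℤ → ℤ
  heaviside (+ _)    = + 1
  heaviside -[1+ _ ] = + 0

  heaviside≢0⇒0≤ : ∀ t → heaviside t ≢ + 0 → + 0 ≤ t
  heaviside≢0⇒0≤ (+ _)    _   = +≤+ z≤n
  heaviside≢0⇒0≤ -[1+ _ ] h≢0 = contradiction refl h≢0

  heaviside-nonneg : ∀ {t} → + 0 ≤ t → heaviside t ≡ + 1
  heaviside-nonneg (+≤+ _) = refl

  heaviside-neg : ∀ {t} → t < + 0 → heaviside t ≡ + 0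
  heaviside-neg { -[1+ _ ]} _         = refl
  heaviside-neg {+ _}      (+<+ ())

  -- weight e y is the coefficient of X^(e y) in (1 - X^e)⁻¹, expanded as
  -- Σ_{y ≥ 0} X^(e y) for e > 0 and as - Σ_{y < 0} X^(e y) for e < 0.
  weight : ℤ → ℤ → ℤ
  weight (+ _)    y = heaviside y
  weight -[1+ _ ] y = heaviside y - + 1

  weight≢0⇒0≤e*y : ∀ e y → weight e y ≢ + 0 → + 0 ≤ e * y
  weight≢0⇒0≤e*y (+ a)    (+ b)    _   = subst (+ 0 ≤_) (pos-* a b) (+≤+ z≤n)
  weight≢0⇒0≤e*y (+ a)    -[1+ b ] w≢0 = contradiction refl w≢0
  weight≢0⇒0≤e*y -[1+ a ] (+ b)    w≢0 = contradiction refl w≢0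
  weight≢0⇒0≤e*y -[1+ a ] -[1+ b ] _   = +≤+ z≤n

  weight-⊖-< : ∀ {p q} v → p ℕ.< q → weight (+ p - + q) v ≡ heaviside v - + 1
  weight-⊖-< {p} {q} v p<q = trans (cong (λ e → weight e v) (trans ([+m]-[+n]≡m⊖n p q) (⊖-< p<q)))
                                   (negative (q ∸ p) (ℕ.m>n⇒m∸n≢0 p<q))
    where
    negative : ∀ r → r ≢ 0 → weight (- + r) v ≡ heaviside v - + 1
    negative zero    r≢0 = contradiction refl r≢0
    negative (suc r) _   = refl

  weight-⊖-≥ : ∀ {p q} v → q ℕ.≤ p → weight (+ p - + q) v ≡ heaviside v
  weight-⊖-≥ {p} {q} v q≤p = cong (λ e → weight e v) (trans ([+m]-[+n]≡m⊖n p q) (⊖-≥ q≤p))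

  -- W as a signed count of lattice points in a box

  Wpos-summand : ℕ → ℕ → List ℕ → ℕ → ℕ
  Wpos-summand n e es x with e ℕ.* x ℕ.≤? n
  ... | yes _ = Wpos (n ∸ e ℕ.* x) es
  ... | no  _ = 0

  mutual
    Wpos-∷ : ∀ n e es → Wpos n (e ∷ es) ≡ foldr ℕ._+_ 0 (map (Wpos-summand n e es) (upTo (suc n)))
    Wpos-∷ zero e es with e ℕ.* 0 ℕ.≤? 0
    ... | yes _ = refl
    ... | no  _ = refl
    Wpos-∷ (suc n) e es with e ℕ.* 0 ℕ.≤? suc n
    ... | yes _ = cong (Wpos (suc n ∸ e ℕ.* 0) es ℕ.+_)
                       (cong (foldr ℕ._+_ 0) (map-cong (Wpos-summand-agrees n e es) (applyUpTo suc (suc n))))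
    ... | no  _ = cong (foldr ℕ._+_ 0) (map-cong (Wpos-summand-agrees n e es) (applyUpTo suc (suc n)))

    -- The summand of Wpos is an anonymous with-function of Defs: its only handle is the instance
    -- of map-cong above, from which this type is inferred. The summand at x = 0, which evaluating
    -- Wpos exposes, is settled by the with in Wpos-∷ instead.
    Wpos-summand-agrees : ∀ n e es x → _
    Wpos-summand-agrees n e es x with e ℕ.* x ℕ.≤? suc n
    ... | yes _ = refl
    ... | no  _ = refl

  Wposℤ : ℤ → List ℕ → ℤ
  Wposℤ (+ n)    es = + Wpos n es
  Wposℤ -[1+ _ ] es = + 0

  Wposℤ-⊖-≥ : ∀ {n k} es → k ℕ.≤ n → Wposℤ (+ n - + k) es ≡ + Wpos (n ∸ k) es
  Wposℤ-⊖-≥ {n} {k} es k≤n = cong (λ m → Wposℤ m es) (trans ([+m]-[+n]≡m⊖n n k) (⊖-≥ k≤n))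

  Wposℤ-⊖-< : ∀ {n k} es → n ℕ.< k → Wposℤ (+ n - + k) es ≡ + 0
  Wposℤ-⊖-< {n} {k} es n<k = begin
    Wposℤ (+ n - + k) es      ≡⟨ cong (λ m → Wposℤ m es) (trans ([+m]-[+n]≡m⊖n n k) (⊖-< n<k)) ⟩
    Wposℤ (- + (k ∸ n)) es    ≡⟨ negative (k ∸ n) (ℕ.m>n⇒m∸n≢0 n<k) ⟩
    + 0                       ∎
    where
    open ≡-Reasoning
    negative : ∀ r → r ≢ 0 → Wposℤ (- + r) es ≡ + 0
    negative zero    r≢0 = contradiction refl r≢0
    negative (suc r) _   = refl

  Wpos-summand≡Wposℤ : ∀ n e es x → + Wpos-summand n e es x ≡ Wposℤ (+ n - + (e ℕ.* x)) es
  Wpos-summand≡Wposℤ n e es x with e ℕ.* x ℕ.≤? n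
  ... | yes ex≤n = sym (Wposℤ-⊖-≥ es ex≤n)
  ... | no  ex≰n = sym (Wposℤ-⊖-< es (ℕ.≰⇒> ex≰n))

  +-foldr-applyUpTo : ∀ (g f : ℕ → ℕ) n →
    + foldr ℕ._+_ 0 (map g (applyUpTo f n)) ≡ ∑ {n} (λ x → + g (f (toℕ x)))
  +-foldr-applyUpTo g f zero    = sym (∑-empty _)
  +-foldr-applyUpTo g f (suc n) = begin
    + (g (f 0) ℕ.+ foldr ℕ._+_ 0 (map g (applyUpTo (f ∘ suc) n)))
      ≡⟨ pos-+ (g (f 0)) _ ⟩
    + g (f 0) + + foldr ℕ._+_ 0 (map g (applyUpTo (f ∘ suc) n))
      ≡⟨ cong (_+_ (+ g (f 0))) (+-foldr-applyUpTo g (f ∘ suc) n) ⟩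
    + g (f 0) + ∑ (λ x → + g (f (suc (toℕ x))))
      ≡⟨ ∑-suc (λ x → + g (f (toℕ x))) ⟨
    ∑ (λ x → + g (f (toℕ x))) ∎
    where open ≡-Reasoning

  ∑-extend : ∀ {m n} (g : ℕ → ℤ) → m ℕ.≤ n → (∀ x → m ℕ.≤ x → g x ≡ + 0) →
    ∑ {m} (λ x → g (toℕ x)) ≡ ∑ {n} (λ x → g (toℕ x))
  ∑-extend {zero}  g _ g≗0 = trans (∑-empty _) (sym (∑-zero (λ x → g≗0 (toℕ x) z≤n)))
  ∑-extend {suc m} {suc n} g (s≤s m≤n) g≗0 = begin
    ∑ {suc m} (λ x → g (toℕ x))
      ≡⟨ ∑-suc _ ⟩
    g 0 + ∑ {m} (λ x → g (suc (toℕ x)))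
      ≡⟨ cong (_+_ (g 0)) (∑-extend (g ∘ suc) m≤n (λ x m≤x → g≗0 (suc x) (s≤s m≤x))) ⟩
    g 0 + ∑ {n} (λ x → g (suc (toℕ x)))
      ≡⟨ ∑-suc _ ⟨
    ∑ {suc n} (λ x → g (toℕ x)) ∎
    where open ≡-Reasoning

  Wposℤ-∷ : ∀ B a as m → m ≤ + B →
    Wposℤ m (suc a ∷ as) ≡ ∑ {suc B} (λ x → Wposℤ (m - + (suc a ℕ.* toℕ x)) as)
  Wposℤ-∷ B a as -[1+ k ] _ =
    sym (∑-zero (λ x → cong (λ m → Wposℤ m as) (neg-minus-pos k (suc a ℕ.* toℕ x))))
  Wposℤ-∷ B a as (+ k) (+≤+ k≤B) = begin
    + Wpos k (suc a ∷ as)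
      ≡⟨ cong +_ (Wpos-∷ k (suc a) as) ⟩
    + foldr ℕ._+_ 0 (map (Wpos-summand k (suc a) as) (upTo (suc k)))
      ≡⟨ +-foldr-applyUpTo (Wpos-summand k (suc a) as) (λ x → x) (suc k) ⟩
    ∑ (λ x → + Wpos-summand k (suc a) as (toℕ x))
      ≡⟨ ∑-cong (λ x → Wpos-summand≡Wposℤ k (suc a) as (toℕ x)) ⟩
    ∑ (λ x → Wposℤ (+ k - + (suc a ℕ.* toℕ x)) as)
      ≡⟨ ∑-extend (λ x → Wposℤ (+ k - + (suc a ℕ.* x)) as) (s≤s k≤B)
                  (λ x k<x → Wposℤ-⊖-< as (ℕ.<-≤-trans k<x (ℕ.m≤n*m x (suc a)))) ⟩
    ∑ (λ x → Wposℤ (+ k - + (suc a ℕ.* toℕ x)) as) ∎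
    where open ≡-Reasoning

  negSum : List ℤ → ℤ
  negSum es = foldr _+_ (+ 0) (negEntries es)

  negSign : List ℤ → ℤ
  negSign es = (- + 1) ℤ.^ length (negEntries es)

  W-unfold : ∀ n es → W n es ≡ negSign es * Wposℤ (n + negSum es) (map ∣_∣ es)
  W-unfold n es with n + negSum es
  ... | -[1+ _ ] = sym (*-zeroʳ (negSign es))
  ... | + _      = refl

  negSum≤0 : ∀ es → negSum es ≤ + 0
  negSum≤0 []              = ≤-refl
  negSum≤0 (+ _ ∷ es)      = negSum≤0 es
  negSum≤0 (-[1+ _ ] ∷ es) = +-mono-≤ -≤+ (negSum≤0 es)

  i+j≤i : ∀ i {j} → j ≤ + 0 → i + j ≤ i
  i+j≤i i j≤0 = subst (i + _ ≤_) (+-identityʳ i) (+-monoʳ-≤ i j≤0)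

  W-∷-pos : ∀ B a es n → n ≤ + B →
    W n (+ suc a ∷ es) ≡ rangeSum B (λ t → weight (+ suc a) t * W (n - + suc a * t) es)
  W-∷-pos B a es n n≤B = begin
    W n (+ suc a ∷ es)
      ≡⟨ W-unfold n (+ suc a ∷ es) ⟩
    negSign es * Wposℤ (n + negSum es) (suc a ∷ as)
      ≡⟨ cong (negSign es *_) (Wposℤ-∷ B a as _ (≤-trans (i+j≤i n (negSum≤0 es)) n≤B)) ⟩
    negSign es * ∑ (λ x → Wposℤ (n + negSum es - + (suc a ℕ.* toℕ x)) as)
      ≡⟨ *-distribˡ-∑ (negSign es) (λ x → Wposℤ (n + negSum es - + (suc a ℕ.* toℕ x)) as) ⟩
    ∑ (λ x → negSign es * Wposℤ (n + negSum es - + (suc a ℕ.* toℕ x)) as)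
      ≡⟨ ∑-cong (λ x → sym (shifted (toℕ x))) ⟩
    ∑ (λ x → + 1 * W (n - + suc a * + toℕ x) es)
      ≡⟨ rangeSum-nonneg B (λ m → *-zeroˡ (W (n - + suc a * -[1+ m ]) es)) ⟨
    rangeSum B (λ t → weight (+ suc a) t * W (n - + suc a * t) es) ∎
    where
    open ≡-Reasoning
    as : List ℕ
    as = map ∣_∣ es
    reorder : ∀ n N p → n - p + N ≡ n + N - p
    reorder = solve-∀
    shifted : ∀ x → + 1 * W (n - + suc a * + x) es ≡ negSign es * Wposℤ (n + negSum es - + (suc a ℕ.* x)) as
    shifted x = begin
      + 1 * W (n - + suc a * + x) es                          ≡⟨ *-identityˡ _ ⟩
      W (n - + suc a * + x) es                                ≡⟨ W-unfold (n - + suc a * + x) es ⟩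
      negSign es * Wposℤ (n - + suc a * + x + negSum es) as   ≡⟨ cong (λ m → negSign es * Wposℤ m as) shift ⟩
      negSign es * Wposℤ (n + negSum es - + (suc a ℕ.* x)) as ∎
      where
      shift : n - + suc a * + x + negSum es ≡ n + negSum es - + (suc a ℕ.* x)
      shift = trans (cong (λ p → n - p + negSum es) (sym (pos-* (suc a) x))) (reorder n (negSum es) _)

  W-∷-neg : ∀ B a es n → n ≤ + B →
    W n (-[1+ a ] ∷ es) ≡ rangeSum B (λ t → weight -[1+ a ] t * W (n - -[1+ a ] * t) es)
  W-∷-neg B a es n n≤B = begin
    W n (-[1+ a ] ∷ es)
      ≡⟨ W-unfold n (-[1+ a ] ∷ es) ⟩
    - + 1 * negSign es * Wposℤ (n + N′) (suc a ∷ as)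
      ≡⟨ cong (- + 1 * negSign es *_) (Wposℤ-∷ B a as _ (≤-trans (i+j≤i n (negSum≤0 (-[1+ a ] ∷ es))) n≤B)) ⟩
    - + 1 * negSign es * ∑ (λ x → Wposℤ (n + N′ - + (suc a ℕ.* toℕ x)) as)
      ≡⟨ *-distribˡ-∑ (- + 1 * negSign es) (λ x → Wposℤ (n + N′ - + (suc a ℕ.* toℕ x)) as) ⟩
    ∑ (λ x → - + 1 * negSign es * Wposℤ (n + N′ - + (suc a ℕ.* toℕ x)) as)
      ≡⟨ ∑-cong (λ x → sym (shifted (toℕ x))) ⟩
    ∑ (λ x → - + 1 * W (n - -[1+ a ] * -[1+ toℕ x ]) es)
      ≡⟨ rangeSum-neg B (λ m → *-zeroˡ (W (n - -[1+ a ] * + m) es)) ⟨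
    rangeSum B (λ t → weight -[1+ a ] t * W (n - -[1+ a ] * t) es) ∎
    where
    open ≡-Reasoning
    as : List ℕ
    as = map ∣_∣ es
    N′ : ℤ
    N′ = -[1+ a ] + negSum es
    -- Used at A = + a and X = + x, where - (+ 1 + A) computes to -[1+ a ].
    reorder : ∀ n N A X → n - (- (+ 1 + A)) * (- (+ 1 + X)) + N ≡ n + (- (+ 1 + A) + N) - (+ 1 + A) * X
    reorder = solve-∀
    shifted : ∀ x → - + 1 * W (n - -[1+ a ] * -[1+ x ]) es ≡ - + 1 * negSign es * Wposℤ (n + N′ - + (suc a ℕ.* x)) as
    shifted x = begin
      - + 1 * W (n - -[1+ a ] * -[1+ x ]) es
        ≡⟨ cong (- + 1 *_) (W-unfold (n - -[1+ a ] * -[1+ x ]) es) ⟩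
      - + 1 * (negSign es * Wposℤ (n - -[1+ a ] * -[1+ x ] + negSum es) as)
        ≡⟨ cong (λ m → - + 1 * (negSign es * Wposℤ m as)) shift ⟩
      - + 1 * (negSign es * Wposℤ (n + N′ - + (suc a ℕ.* x)) as)
        ≡⟨ *-assoc (- + 1) (negSign es) _ ⟨
      - + 1 * negSign es * Wposℤ (n + N′ - + (suc a ℕ.* x)) as ∎
      where
      shift : n - -[1+ a ] * -[1+ x ] + negSum es ≡ n + N′ - + (suc a ℕ.* x)
      shift = trans (reorder n (negSum es) (+ a) (+ x)) (cong (λ p → n + N′ - p) (sym (pos-* (suc a) x)))

  W-∷ : ∀ B e es n → e ≢ + 0 → n ≤ + B →
    W n (e ∷ es) ≡ rangeSum B (λ t → weight e t * W (n - e * t) es)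
  W-∷ B (+ zero)  es n e≢0 _   = contradiction refl e≢0
  W-∷ B (+ suc a) es n _   n≤B = W-∷-pos B a es n n≤B
  W-∷ B -[1+ a ]  es n _   n≤B = W-∷-neg B a es n n≤B

  W-[] : ∀ n → W n [] ≡ 𝟙[ + 0 ≡ n ]
  W-[] (+ zero)  = sym (𝟙-≡ refl)
  W-[] (+ suc _) = sym (𝟙-≢ (λ ()))
  W-[] -[1+ _ ]  = sym (𝟙-≢ (λ ()))

  negEntries-+ : ∀ {k} (f : Fin k → ℕ) → negEntries (toList (λ j → + f j)) ≡ []
  negEntries-+ {zero}  f = refl
  negEntries-+ {suc k} f = negEntries-+ (f ∘ suc)

  map-∣∣-+ : ∀ {k} (f : Fin k → ℕ) → map ∣_∣ (toList (λ j → + f j)) ≡ toList f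
  map-∣∣-+ {zero}  f = refl
  map-∣∣-+ {suc k} f = cong (f zero ∷_) (map-∣∣-+ (f ∘ suc))

  W-+ : ∀ {k} s (f : Fin k → ℕ) → W (+ s) (toList (λ j → + f j)) ≡ + Wpos s (toList f)
  W-+ s f = begin
    W (+ s) es                                          ≡⟨ W-unfold (+ s) es ⟩
    negSign es * Wposℤ (+ s + negSum es) (map ∣_∣ es)
      ≡⟨ cong (λ ns → (- + 1) ℤ.^ length ns * Wposℤ (+ s + foldr _+_ (+ 0) ns) (map ∣_∣ es)) (negEntries-+ f) ⟩
    + 1 * Wposℤ (+ s + + 0) (map ∣_∣ es)                ≡⟨ *-identityˡ _ ⟩
    Wposℤ (+ s + + 0) (map ∣_∣ es)                      ≡⟨ cong₂ Wposℤ (+-identityʳ (+ s)) (map-∣∣-+ f) ⟩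
    + Wpos s (toList f)                                 ∎
    where
    open ≡-Reasoning
    es : List ℤ
    es = toList (λ j → + f j)

  dot : ∀ {k} → (Fin k → ℤ) → Vec ℤ k → ℤ
  dot e y = ∑ (λ j → e j * lookup y j)

  weightProd : ∀ {k} → (Fin k → ℤ) → Vec ℤ k → ℤ
  weightProd e y = ∏ (λ j → weight (e j) (lookup y j))

  dot-insertAt : ∀ {n} (e : Fin (suc n) → ℤ) (y : Vec ℤ n) i t →
    dot e (insertAt y i t) ≡ e i * t + dot (e ∘ punchIn i) y
  dot-insertAt e = ∑-insertAt (λ j v → e j * v)

  weightProd-insertAt : ∀ {n} (e : Fin (suc n) → ℤ) (y : Vec ℤ n) i t →
    weightProd e (insertAt y i t) ≡ weight (e i) t * weightProd (e ∘ punchIn i) y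
  weightProd-insertAt e = ∏-insertAt (λ j → weight (e j))

  W-boxSum : ∀ B k (e : Fin k → ℤ) → (∀ j → e j ≢ + 0) → ∀ n → n ≤ + B →
    W n (toList e) ≡ boxSum B k (λ y → 𝟙[ dot e y ≡ n ] * weightProd e y)
  W-boxSum B zero e _ n _ = begin
    W n []                              ≡⟨ W-[] n ⟩
    𝟙[ + 0 ≡ n ]                        ≡⟨ *-identityʳ _ ⟨
    𝟙[ + 0 ≡ n ] * + 1                  ≡⟨ cong₂ (λ s p → 𝟙[ s ≡ n ] * p) (∑-empty _) (∏-empty _) ⟨
    𝟙[ dot e [] ≡ n ] * weightProd e [] ∎
    where open ≡-Reasoning
  W-boxSum B (suc k) e e≢0 n n≤B =
    trans (W-∷ B (e zero) (toList e′) n (e≢0 zero) n≤B) (rangeSum-cong B slice)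
    where
    e′ : Fin k → ℤ
    e′ = e ∘ suc
    summand : Vec ℤ (suc k) → ℤ
    summand y = 𝟙[ dot e y ≡ n ] * weightProd e y
    summand-∷ : ∀ t y →
      summand (t ∷ y) ≡ 𝟙[ e zero * t + dot e′ y ≡ n ] * (weight (e zero) t * weightProd e′ y)
    summand-∷ t y = cong₂ (λ s p → 𝟙[ s ≡ n ] * p) (∑-suc _) (∏-suc _)
    slice : ∀ t → weight (e zero) t * W (n - e zero * t) (toList e′) ≡ boxSum B k (λ y → summand (t ∷ y))
    slice t with weight (e zero) t ≟ + 0
    ... | yes w≡0 = trans (cong (_* W (n - e zero * t) (toList e′)) w≡0) (sym (boxSum-zero B k summand≡0))
      where
      summand≡0 : ∀ y → summand (t ∷ y) ≡ + 0
      summand≡0 y = trans (summand-∷ t y) (𝟙-*-≢ _ (λ _ → cong (_* weightProd e′ y) w≡0))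
    ... | no  w≢0 = begin
      w * W (n - e zero * t) (toList e′)
        ≡⟨ cong (w *_) (W-boxSum B k e′ (e≢0 ∘ suc) (n - e zero * t) n-et≤B) ⟩
      w * boxSum B k (λ y → 𝟙[ dot e′ y ≡ n - e zero * t ] * weightProd e′ y)
        ≡⟨ boxSum-*ˡ B k w (λ y → 𝟙[ dot e′ y ≡ n - e zero * t ] * weightProd e′ y) ⟨
      boxSum B k (λ y → w * (𝟙[ dot e′ y ≡ n - e zero * t ] * weightProd e′ y))
        ≡⟨ boxSum-cong B k (λ y → trans (regroup y) (sym (summand-∷ t y))) ⟩
      boxSum B k (λ y → summand (t ∷ y)) ∎
      where
      open ≡-Reasoning
      w : ℤ
      w = weight (e zero) t
      n-et≤B : n - e zero * t ≤ + B
      n-et≤B = ≤-trans (i-j≤i n (e zero * t) {{nonNegative (weight≢0⇒0≤e*y (e zero) t w≢0)}}) n≤B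
      a+[n-a]≡n : ∀ a n → a + (n - a) ≡ n
      a+[n-a]≡n = solve-∀
      [a+s]-a≡s : ∀ a s → a + s - a ≡ s
      [a+s]-a≡s = solve-∀
      move-left : ∀ s → s ≡ n - e zero * t → e zero * t + s ≡ n
      move-left s refl = a+[n-a]≡n (e zero * t) n
      move-right : ∀ s → e zero * t + s ≡ n → s ≡ n - e zero * t
      move-right s refl = sym ([a+s]-a≡s (e zero * t) s)
      regroup : ∀ y → w * (𝟙[ dot e′ y ≡ n - e zero * t ] * weightProd e′ y)
                      ≡ 𝟙[ e zero * t + dot e′ y ≡ n ] * (w * weightProd e′ y)
      regroup y = trans (x*[y*z]≡y*[x*z] w 𝟙[ dot e′ y ≡ n - e zero * t ] (weightProd e′ y))
                        (cong (_* (w * weightProd e′ y)) (𝟙-cong-⇔ (move-left (dot e′ y)) (move-right (dot e′ y))))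

  -- Telescoping along a strict total order

  Connex≢ : ∀ {n} → Rel (Fin n) 0ℓ → Set
  Connex≢ _≺_ = ∀ {i j} → i ≢ j → i ≺ j ⊎ j ≺ i

  maximum : ∀ {n} (_≺_ : Rel (Fin (suc n)) 0ℓ) → Connex≢ _≺_ → Transitive _≺_ →
    ∃ λ i₀ → ∀ j → j ≢ i₀ → j ≺ i₀
  maximum {zero}  _≺_ connex trans≺ = zero , λ { zero 0≢0 → contradiction refl 0≢0 }
  maximum {suc n} _≺_ connex trans≺
    with maximum (λ i j → suc i ≺ suc j) (λ i≢j → connex (i≢j ∘ Fin.suc-injective)) trans≺
  ... | i₁ , max₁ with connex {zero} {suc i₁} (λ ())
  ...   | inj₁ 0≺i₁ = suc i₁ , λ { zero _ → 0≺i₁ ; (suc j) j≢i₁ → max₁ j (j≢i₁ ∘ cong suc) }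
  ...   | inj₂ i₁≺0 = zero , below-zero
    where
    below-zero : ∀ j → j ≢ zero → j ≺ zero
    below-zero zero    0≢0 = contradiction refl 0≢0
    below-zero (suc j) _ with j Fin.≟ i₁
    ... | yes refl = i₁≺0
    ... | no  j≢i₁ = trans≺ (max₁ j j≢i₁) i₁≺0

  -- Removing the ≺-maximal index i₀ from both the sum and the products yields the recursion.
  telescope : ∀ {n} (_≺_ : Rel (Fin n) 0ℓ) → Connex≢ _≺_ → Transitive _≺_ →
    (a : Fin n → ℤ) (F : Fin n → Fin n → ℤ) → (∀ i → F i i ≡ + 1) →
    (∀ {i j} → i ≺ j → F i j ≡ a j - + 1) → (∀ {i j} → j ≺ i → F i j ≡ a j) →
    ∑ (λ i → ∏ (F i)) ≡ ∏ a - ∏ (λ j → a j - + 1)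
  telescope {zero} _ _ _ a F _ _ _ =
    trans (∑-empty _) (sym (cong₂ _-_ (∏-empty a) (∏-empty (λ j → a j - + 1))))
  telescope {suc n} _≺_ connex trans≺ a F diag below above with maximum _≺_ connex trans≺
  ... | i₀ , max = begin
    ∑ (λ i → ∏ (F i))                 ≡⟨ ∑-remove i₀ (λ i → ∏ (F i)) ⟩
    ∏ (F i₀) + ∑ (λ i → ∏ (F (p i)))  ≡⟨ cong₂ _+_ top rest ⟩
    A′ + (a i₀ - + 1) * (A′ - Q′)     ≡⟨ recombine (a i₀) A′ Q′ ⟩
    a i₀ * A′ - (a i₀ - + 1) * Q′     ≡⟨ cong₂ _-_ (∏-remove i₀ a) (∏-remove i₀ (λ j → a j - + 1)) ⟨
    ∏ a - ∏ (λ j → a j - + 1)         ∎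
    where
    open ≡-Reasoning
    p : Fin n → Fin (suc n)
    p = punchIn i₀
    A′ Q′ : ℤ
    A′ = ∏ (a ∘ p)
    Q′ = ∏ (λ j → a (p j) - + 1)
    recombine : ∀ x A Q → A + (x - + 1) * (A - Q) ≡ x * A - (x - + 1) * Q
    recombine = solve-∀
    p≺i₀ : ∀ j → p j ≺ i₀
    p≺i₀ j = max (p j) (Fin.punchInᵢ≢i i₀ j)
    top : ∏ (F i₀) ≡ A′
    top = begin
      ∏ (F i₀)                ≡⟨ ∏-remove i₀ (F i₀) ⟩
      F i₀ i₀ * ∏ (F i₀ ∘ p)  ≡⟨ cong₂ _*_ (diag i₀) (∏-cong (λ j → above (p≺i₀ j))) ⟩
      + 1 * A′                ≡⟨ *-identityˡ A′ ⟩
      A′                      ∎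
    rest : ∑ (λ i → ∏ (F (p i))) ≡ (a i₀ - + 1) * (A′ - Q′)
    rest = begin
      ∑ (λ i → ∏ (F (p i)))
        ≡⟨ ∑-cong (λ i → trans (∏-remove i₀ (F (p i))) (cong (_* ∏ (F (p i) ∘ p)) (below (p≺i₀ i)))) ⟩
      ∑ (λ i → (a i₀ - + 1) * ∏ (F (p i) ∘ p))
        ≡⟨ *-distribˡ-∑ (a i₀ - + 1) (λ i → ∏ (F (p i) ∘ p)) ⟨
      (a i₀ - + 1) * ∑ (λ i → ∏ (F (p i) ∘ p))
        ≡⟨ cong ((a i₀ - + 1) *_) (telescope (λ i j → p i ≺ p j)
              (λ i≢j → connex (i≢j ∘ Fin.punchIn-injective i₀ _ _)) trans≺
              (a ∘ p) (λ i j → F (p i) (p j)) (diag ∘ p) below above) ⟩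
      (a i₀ - + 1) * (A′ - Q′) ∎

  -- Linear equations over an integer interval

  linear-unique : ∀ D {t t₀ v w} .{{_ : ℤ.NonZero D}} → D * t + v ≡ w → D * t₀ + v ≡ w → t ≡ t₀
  linear-unique D {t} {t₀} {v} eq eq₀ =
    *-cancelˡ-≡ D t t₀ (+-cancelʳ-≡ v (D * t) (D * t₀) (trans eq (sym eq₀)))

  rangeSum-𝟙-linear-none : ∀ B D {v w} (g : ℤ → ℤ) → (∀ t → D * t + v ≢ w) →
    rangeSum B (λ t → 𝟙[ D * t + v ≡ w ] * g t) ≡ + 0
  rangeSum-𝟙-linear-none B D g no-solution =
    rangeSum-zero B (λ t → 𝟙-*-≢ (g t) (λ eq → contradiction eq (no-solution t)))

  rangeSum-𝟙-linear-solution : ∀ B D {v w t₀} .{{_ : ℤ.NonZero D}} (g : ℤ → ℤ) → D * t₀ + v ≡ w →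
    (g t₀ ≢ + 0 → -[1+ B ] ≤ t₀ × t₀ ≤ + B) →
    rangeSum B (λ t → 𝟙[ D * t + v ≡ w ] * g t) ≡ g t₀
  rangeSum-𝟙-linear-solution B D {v} {w} {t₀} g solution in-range with g t₀ ≟ + 0
  ... | yes g≡0 = trans (rangeSum-zero B (λ t → 𝟙-*-≢ (g t) (λ eq → trans (cong g (unique eq)) g≡0))) (sym g≡0)
    where
    unique : ∀ {t} → D * t + v ≡ w → t ≡ t₀
    unique eq = linear-unique D eq solution
  ... | no  g≢0 with in-range g≢0
  ...   | lo , hi = begin
    rangeSum B (λ t → 𝟙[ D * t + v ≡ w ] * g t)  ≡⟨ rangeSum-single B lo hi away ⟩
    𝟙[ D * t₀ + v ≡ w ] * g t₀                   ≡⟨ cong (_* g t₀) (𝟙-≡ solution) ⟩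
    + 1 * g t₀                                   ≡⟨ *-identityˡ (g t₀) ⟩
    g t₀                                         ∎
    where
    open ≡-Reasoning
    away : ∀ t → t ≢ t₀ → 𝟙[ D * t + v ≡ w ] * g t ≡ + 0
    away t t≢t₀ = 𝟙-*-≢ (g t) (λ eq → contradiction (linear-unique D eq solution) t≢t₀)

  nonneg-solution-≤ : ∀ D .{{_ : ℕ.NonZero D}} {T u N} → + 0 ≤ T → + 0 ≤ u → + D * T + u ≡ + N →
    ∣ T ∣ ℕ.≤ N × ∣ u ∣ ℕ.≤ N
  nonneg-solution-≤ D {+ n} {+ m} {N} _ _ eq =
    ℕ.≤-trans (ℕ.m≤n*m n D) (ℕ.≤-trans (ℕ.m≤m+n (D ℕ.* n) m) Dn+m≤N) ,
    ℕ.≤-trans (ℕ.m≤n+m m _) Dn+m≤N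
    where
    Dn+m≤N : D ℕ.* n ℕ.+ m ℕ.≤ N
    Dn+m≤N = ℕ.≤-reflexive (+-injective (trans (trans (pos-+ (D ℕ.* n) m) (cong (_+ + m) (pos-* D n))) eq))

  module _ (D δ s σ a c : ℤ) where

    lhs-equation⇒ : ∀ t → D * t + (δ * a - D * c) ≡ s * δ + σ * D → δ * (s - a) ≡ (t - σ - c) * D
    lhs-equation⇒ t eq = begin
      δ * (s - a)                                  ≡⟨ isolate D δ s σ a ⟩
      (s * δ + σ * D) - σ * D - δ * a              ≡⟨ cong (λ x → x - σ * D - δ * a) eq ⟨
      (D * t + (δ * a - D * c)) - σ * D - δ * a    ≡⟨ collect D δ σ a c t ⟩
      (t - σ - c) * D                              ∎
      where
      open ≡-Reasoning
      isolate : ∀ D δ s σ a → δ * (s - a) ≡ (s * δ + σ * D) - σ * D - δ * a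
      isolate = solve-∀
      collect : ∀ D δ σ a c t → (D * t + (δ * a - D * c)) - σ * D - δ * a ≡ (t - σ - c) * D
      collect = solve-∀

    rhs-equation⇒ : ∀ t → D * t + a ≡ s → s - a ≡ t * D
    rhs-equation⇒ t eq = begin
      s - a            ≡⟨ cong (_- a) eq ⟨
      D * t + a - a    ≡⟨ cancel D t a ⟩
      t * D            ∎
      where
      open ≡-Reasoning
      cancel : ∀ D t a → D * t + a - a ≡ t * D
      cancel = solve-∀

    module _ (t′ : ℤ) (s-a≡t′D : s - a ≡ t′ * D) where

      lhs-solution : D * (σ + (δ * t′ + c)) + (δ * a - D * c) ≡ s * δ + σ * D
      lhs-solution = begin
        D * (σ + (δ * t′ + c)) + (δ * a - D * c)   ≡⟨ expand D δ σ a c t′ ⟩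
        D * σ + δ * (t′ * D) + δ * a               ≡⟨ cong (λ x → D * σ + δ * x + δ * a) s-a≡t′D ⟨
        D * σ + δ * (s - a) + δ * a                ≡⟨ simplify D δ s σ a ⟩
        s * δ + σ * D                              ∎
        where
        open ≡-Reasoning
        expand : ∀ D δ σ a c t′ → D * (σ + (δ * t′ + c)) + (δ * a - D * c) ≡ D * σ + δ * (t′ * D) + δ * a
        expand = solve-∀
        simplify : ∀ D δ s σ a → D * σ + δ * (s - a) + δ * a ≡ s * δ + σ * D
        simplify = solve-∀

      rhs-solution : D * t′ + a ≡ s
      rhs-solution = begin
        D * t′ + a         ≡⟨ cong (_+ a) (trans (*-comm D t′) (sym s-a≡t′D)) ⟩
        s - a + a          ≡⟨ cancel s a ⟩
        s                  ∎
        where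
        open ≡-Reasoning
        cancel : ∀ s a → s - a + a ≡ s
        cancel = solve-∀

  +[s*δ+σ*D]≡ : ∀ s σ D δ → + (s ℕ.* δ ℕ.+ σ ℕ.* D) ≡ + s * + δ + + σ * + D
  +[s*δ+σ*D]≡ s σ D δ = trans (pos-+ (s ℕ.* δ) (σ ℕ.* D)) (cong₂ _+_ (pos-* s δ) (pos-* σ D))

  -- The substitution t = σ + δ t′ + c matches the solutions of the two linear equations:
  -- coprimality of D and δ makes both solvable exactly when D divides s - a.
  rangeSum-substitution : ∀ B K s σ D δ .{{_ : ℕ.NonZero D}} → Coprime D δ → ∀ a c u →
    u ≡ + δ * a - + D * c → + 0 ≤ u → ∣ a ∣ ℕ.≤ K ℕ.* ∣ u ∣ →
    s ℕ.* δ ℕ.+ σ ℕ.* D ℕ.≤ B → s ℕ.+ K ℕ.* (s ℕ.* δ ℕ.+ σ ℕ.* D) ℕ.≤ B →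
    rangeSum B (λ t → 𝟙[ + D * t + u ≡ + (s ℕ.* δ ℕ.+ σ ℕ.* D) ] * heaviside t)
      ≡ rangeSum B (λ t → 𝟙[ + D * t + a ≡ + s ] * heaviside (+ σ + (+ δ * t + c)))
  rangeSum-substitution B K s σ D δ coprime a c u u≡ 0≤u ∣a∣≤K∣u∣ N≤B s+KN≤B with + D ∣? (+ s - a)
  ... | no D∤s-a = trans (rangeSum-𝟙-linear-none B (+ D) heaviside lhs-none)
                         (sym (rangeSum-𝟙-linear-none B (+ D) (λ t → heaviside (+ σ + (+ δ * t + c))) rhs-none))
    where
    rhs-none : ∀ t → + D * t + a ≢ + s
    rhs-none t eq = D∤s-a (divides t (rhs-equation⇒ (+ D) (+ δ) (+ s) (+ σ) a c t eq))
    lhs-none : ∀ t → + D * t + u ≢ + (s ℕ.* δ ℕ.+ σ ℕ.* D)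
    lhs-none t eq =
      D∤s-a (∣ᵤ⇒∣ (ℤ.coprime-divisor (+ D) (+ δ) (+ s - a) coprime (∣⇒∣ᵤ (divides (t - + σ - c) δ[s-a]≡))))
      where
      δ[s-a]≡ : + δ * (+ s - a) ≡ (t - + σ - c) * + D
      δ[s-a]≡ = lhs-equation⇒ (+ D) (+ δ) (+ s) (+ σ) a c t
                  (trans (cong (_+_ (+ D * t)) (sym u≡)) (trans eq (+[s*δ+σ*D]≡ s σ D δ)))
  ... | yes (divides t′ s-a≡t′D) = trans (rangeSum-𝟙-linear-solution B (+ D) heaviside lhs-solved T-in-range)
                                         (sym (rangeSum-𝟙-linear-solution B (+ D) (λ t → heaviside (+ σ + (+ δ * t + c)))
                                                (rhs-solution (+ D) (+ δ) (+ s) (+ σ) a c t′ s-a≡t′D) t′-in-range))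
    where
    N : ℕ
    N = s ℕ.* δ ℕ.+ σ ℕ.* D
    T : ℤ
    T = + σ + (+ δ * t′ + c)
    lhs-solved : + D * T + u ≡ + N
    lhs-solved = trans (cong (_+_ (+ D * T)) u≡)
                       (trans (lhs-solution (+ D) (+ δ) (+ s) (+ σ) a c t′ s-a≡t′D) (sym (+[s*δ+σ*D]≡ s σ D δ)))
    bounds : heaviside T ≢ + 0 → ∣ T ∣ ℕ.≤ N × ∣ u ∣ ℕ.≤ N
    bounds h≢0 = nonneg-solution-≤ D (heaviside≢0⇒0≤ T h≢0) 0≤u lhs-solved
    T-in-range : heaviside T ≢ + 0 → -[1+ B ] ≤ T × T ≤ + B
    T-in-range h≢0 = ∣t∣≤B⇒inRange T (ℕ.≤-trans (proj₁ (bounds h≢0)) N≤B)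
    t′-in-range : heaviside T ≢ + 0 → -[1+ B ] ≤ t′ × t′ ≤ + B
    t′-in-range h≢0 = ∣t∣≤B⇒inRange t′ (ℕ.≤-trans ∣t′∣≤∣s-a∣ (ℕ.≤-trans ∣s-a∣≤s+KN s+KN≤B))
      where
      ∣t′∣≤∣s-a∣ : ∣ t′ ∣ ℕ.≤ ∣ + s - a ∣
      ∣t′∣≤∣s-a∣ = ℕ.≤-trans (ℕ.m≤m*n ∣ t′ ∣ D)
                             (ℕ.≤-reflexive (trans (sym (abs-* t′ (+ D))) (cong ∣_∣ (sym s-a≡t′D))))
      ∣s-a∣≤s+KN : ∣ + s - a ∣ ℕ.≤ s ℕ.+ K ℕ.* N
      ∣s-a∣≤s+KN = ℕ.≤-trans (∣i-j∣≤∣i∣+∣j∣ (+ s) a)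
                             (ℕ.+-monoʳ-≤ s (ℕ.≤-trans ∣a∣≤K∣u∣ (ℕ.*-monoʳ-≤ K (proj₂ (bounds h≢0)))))

  -- The vectors d_i

  module _ {m} (d δ : Fin m → ℕ) where

    dVec-diag : ∀ i → dVec d δ i i ≡ + d i
    dVec-diag i with i Fin.≟ i
    ... | yes _   = refl
    ... | no  i≢i = contradiction refl i≢i

    dVec-off : ∀ {i j} → i ≢ j → dVec d δ i j ≡ + (δ i ℕ.* d j) - + (δ j ℕ.* d i)
    dVec-off {i} {j} i≢j with i Fin.≟ j
    ... | yes i≡j = contradiction i≡j i≢j
    ... | no  _   = refl

    -- i ≺ j says that the entry d_{i,j} = δ_i d_j - δ_j d_i is negative.
    _≺_ : Rel (Fin m) 0ℓ
    i ≺ j = δ i ℕ.* d j ℕ.< δ j ℕ.* d i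

    ≺-trans : Transitive _≺_
    ≺-trans {i} {j} {k} i≺j j≺k = ℕ.*-cancelʳ-< (δ j ℕ.* d j) (δ i ℕ.* d k) (δ k ℕ.* d i)
      (subst₂ ℕ._<_ (regroup (δ i) (d j) (δ j) (d k)) (regroup′ (δ j) (d i) (δ k) (d j)) (ℕ.*-mono-< i≺j j≺k))
      where
      regroup : ∀ a b c e → (a ℕ.* b) ℕ.* (c ℕ.* e) ≡ (a ℕ.* e) ℕ.* (c ℕ.* b)
      regroup = ℕ.solve-∀
      regroup′ : ∀ a b c e → (a ℕ.* b) ℕ.* (c ℕ.* e) ≡ (c ℕ.* b) ℕ.* (a ℕ.* e)
      regroup′ = ℕ.solve-∀

    ≺-connex : (∀ i j → i ≢ j → δ i ℕ.* d j ≢ δ j ℕ.* d i) → Connex≢ _≺_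
    ≺-connex distinct {i} {j} i≢j with ℕ.<-cmp (δ i ℕ.* d j) (δ j ℕ.* d i)
    ... | tri< i≺j _ _ = inj₁ i≺j
    ... | tri≈ _ eq _  = contradiction eq (distinct i j i≢j)
    ... | tri> _ _ j≺i = inj₂ j≺i

    rowWeight : Fin m → Fin m → ℤ → ℤ
    rowWeight i j v with i Fin.≟ j
    ... | yes _ = + 1
    ... | no  _ = weight (+ (δ i ℕ.* d j) - + (δ j ℕ.* d i)) v

    rowWeight-diag : ∀ i v → rowWeight i i v ≡ + 1
    rowWeight-diag i v with i Fin.≟ i
    ... | yes _   = refl
    ... | no  i≢i = contradiction refl i≢i

    rowWeight-off : ∀ {i j} v → i ≢ j → rowWeight i j v ≡ weight (+ (δ i ℕ.* d j) - + (δ j ℕ.* d i)) v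
    rowWeight-off {i} {j} v i≢j with i Fin.≟ j
    ... | yes i≡j = contradiction i≡j i≢j
    ... | no  _   = refl

    rowWeight-≺ : ∀ {i j} v → i ≺ j → rowWeight i j v ≡ heaviside v - + 1
    rowWeight-≺ {i} {j} v i≺j = trans (rowWeight-off v i≢j) (weight-⊖-< v i≺j)
      where
      i≢j : i ≢ j
      i≢j refl = ℕ.<-irrefl refl i≺j

    rowWeight-≻ : ∀ {i j} v → j ≺ i → rowWeight i j v ≡ heaviside v
    rowWeight-≻ {i} {j} v j≺i = trans (rowWeight-off v i≢j) (weight-⊖-≥ v (ℕ.<⇒≤ j≺i))
      where
      i≢j : i ≢ j
      i≢j refl = ℕ.<-irrefl refl j≺i

    dVec-punchIn-dot : ∀ i {k} (y : Vec ℤ k) (p : Fin k → Fin m) → (∀ j → p j ≢ i) →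
      dot (dVec d δ i ∘ p) y ≡ + δ i * dot (λ j → + d (p j)) y - + d i * dot (λ j → + δ (p j)) y
    dVec-punchIn-dot i y p p≢i = trans (∑-cong term) (∑-linear (+ δ i) (+ d i) _ _)
      where
      expand : ∀ a b c e y → (a * b - c * e) * y ≡ a * (b * y) - e * (c * y)
      expand = solve-∀
      term : ∀ j → dVec d δ i (p j) * lookup y j
                   ≡ + δ i * (+ d (p j) * lookup y j) - + d i * (+ δ (p j) * lookup y j)
      term j = begin
        dVec d δ i (p j) * lookup y j
          ≡⟨ cong (_* lookup y j) (trans (dVec-off (p≢i j ∘ sym)) entry) ⟩
        (+ δ i * + d (p j) - + δ (p j) * + d i) * lookup y j
          ≡⟨ expand (+ δ i) (+ d (p j)) (+ δ (p j)) (+ d i) (lookup y j) ⟩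
        + δ i * (+ d (p j) * lookup y j) - + d i * (+ δ (p j) * lookup y j) ∎
        where
        open ≡-Reasoning
        entry : + (δ i ℕ.* d (p j)) - + (δ (p j) ℕ.* d i) ≡ + δ i * + d (p j) - + δ (p j) * + d i
        entry = cong₂ _-_ (pos-* (δ i) (d (p j))) (pos-* (δ (p j)) (d i))

  module Identity {m′} (d δ : Fin (suc m′) → ℕ) (d>0 : ∀ i → d i ℕ.> 0)
    (coprime : ∀ i → gcd (δ i) (d i) ≡ 1) (distinct : ∀ i j → i ≢ j → δ i ℕ.* d j ≢ δ j ℕ.* d i)
    (σ s : ℕ) where

    m : ℕ
    m = suc m′

    dℤ δℤ : Fin m → ℤ
    dℤ j = + d j
    δℤ j = + δ j

    N : Fin m → ℕ
    N i = s ℕ.* δ i ℕ.+ σ ℕ.* d i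

    -- B bounds every N i and s, and leaves room for the solutions met in rangeSum-substitution.
    K M B : ℕ
    K = sumℕ d
    M = s ℕ.* sumℕ δ ℕ.+ σ ℕ.* K
    B = M ℕ.+ (s ℕ.+ K ℕ.* M)

    N≤M : ∀ i → N i ℕ.≤ M
    N≤M i = ℕ.+-mono-≤ (ℕ.*-monoʳ-≤ s (≤-sumℕ δ i)) (ℕ.*-monoʳ-≤ σ (≤-sumℕ d i))

    N≤B : ∀ i → N i ℕ.≤ B
    N≤B i = ℕ.≤-trans (N≤M i) (ℕ.m≤m+n M _)

    s+KN≤B : ∀ i → s ℕ.+ K ℕ.* N i ℕ.≤ B
    s+KN≤B i = ℕ.≤-trans (ℕ.+-monoʳ-≤ s (ℕ.*-monoʳ-≤ K (N≤M i))) (ℕ.m≤n+m _ M)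

    s≤B : s ℕ.≤ B
    s≤B = ℕ.≤-trans (ℕ.m≤m+n s _) (ℕ.m≤n+m _ M)

    dVec≢0 : ∀ i j → dVec d δ i j ≢ + 0
    dVec≢0 i j with i Fin.≟ j
    ... | yes refl = ℕ.>⇒≢ (d>0 i) ∘ +-injective
    ... | no  i≢j  = distinct i j i≢j ∘ +-injective ∘ i-j≡0⇒i≡j _ _

    summand substituted : Fin m → Vec ℤ m → ℤ
    summand i x = 𝟙[ dot (dVec d δ i) x ≡ + N i ] * weightProd (dVec d δ i) x
    substituted i x =
      𝟙[ dot dℤ x ≡ + s ] * heaviside (+ σ + dot δℤ x) * ∏ (λ j → rowWeight d δ i j (lookup x j))

    module Slice (i : Fin m) (y : Vec ℤ m′) where

      E′ : Fin m′ → ℤ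
      E′ = dVec d δ i ∘ punchIn i

      u a c P : ℤ
      u = dot E′ y
      a = dot (dℤ ∘ punchIn i) y
      c = dot (δℤ ∘ punchIn i) y
      P = weightProd E′ y

      L R : ℤ → ℤ
      L t = 𝟙[ + d i * t + u ≡ + N i ] * heaviside t
      R t = 𝟙[ + d i * t + a ≡ + s ] * heaviside (+ σ + (+ δ i * t + c))

      summand-at : ∀ t → summand i (insertAt y i t) ≡ P * L t
      summand-at t = trans
        (cong₂ (λ x w → 𝟙[ x ≡ + N i ] * w)
               (trans (dot-insertAt (dVec d δ i) y i t) (cong (λ e → e * t + u) (dVec-diag d δ i)))
               (trans (weightProd-insertAt (dVec d δ i) y i t) (cong (λ e → weight e t * P) (dVec-diag d δ i))))
        (rearrange 𝟙[ + d i * t + u ≡ + N i ] (heaviside t) P)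
        where
        rearrange : ∀ I H P → I * (H * P) ≡ P * (I * H)
        rearrange = solve-∀

      rowWeights≡P : ∏ (λ j → rowWeight d δ i (punchIn i j) (lookup y j)) ≡ P
      rowWeights≡P = ∏-cong (λ j → trans (rowWeight-off d δ (lookup y j) (pᵢⱼ≢i j))
                                         (cong (λ e → weight e (lookup y j)) (sym (dVec-off d δ (pᵢⱼ≢i j)))))
        where
        pᵢⱼ≢i : ∀ j → i ≢ punchIn i j
        pᵢⱼ≢i j = Fin.punchInᵢ≢i i j ∘ sym

      substituted-at : ∀ t → substituted i (insertAt y i t) ≡ P * R t
      substituted-at t = trans
        (cong₃ (dot-insertAt dℤ y i t) (dot-insertAt δℤ y i t)
               (trans (∏-insertAt (rowWeight d δ i) y i t) (cong₂ _*_ (rowWeight-diag d δ i t) rowWeights≡P)))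
        (rearrange 𝟙[ + d i * t + a ≡ + s ] (heaviside (+ σ + (+ δ i * t + c))) P)
        where
        cong₃ : ∀ {x x′ z z′ w w′} → x ≡ x′ → z ≡ z′ → w ≡ w′ →
          𝟙[ x ≡ + s ] * heaviside (+ σ + z) * w ≡ 𝟙[ x′ ≡ + s ] * heaviside (+ σ + z′) * w′
        cong₃ refl refl refl = refl
        rearrange : ∀ I H P → I * H * (+ 1 * P) ≡ P * (I * H)
        rearrange = solve-∀

      substitution-applies : P ≢ + 0 → rangeSum B L ≡ rangeSum B R
      substitution-applies P≢0 =
        rangeSum-substitution B K s σ (d i) (δ i) {{ℕ.>-nonZero (d>0 i)}} (ℕ.sym (ℕ.gcd≡1⇒coprime (coprime i)))
          a c u u≡ (∑-nonneg _ 0≤terms) ∣a∣≤K∣u∣ (N≤B i) (s+KN≤B i)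
        where
        0≤terms : ∀ j → + 0 ≤ E′ j * lookup y j
        0≤terms j = weight≢0⇒0≤e*y (E′ j) (lookup y j) (∏≢0⇒≢0 _ P≢0 j)
        u≡ : u ≡ + δ i * a - + d i * c
        u≡ = dVec-punchIn-dot d δ i y (punchIn i) (Fin.punchInᵢ≢i i)
        ∣a∣≤K∣u∣ : ∣ a ∣ ℕ.≤ K ℕ.* ∣ u ∣
        ∣a∣≤K∣u∣ = ∣∑∣≤K∣∑∣ K _ _ (λ j → ∣c*y∣≤K∣e*y∣ (dℤ (punchIn i j)) (E′ j) (lookup y j)
                                           (≤-sumℕ d (punchIn i j)) (dVec≢0 i (punchIn i j)))
                            0≤terms

      slice : rangeSum B (λ t → summand i (insertAt y i t)) ≡ rangeSum B (λ t → substituted i (insertAt y i t))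
      slice = begin
        rangeSum B (λ t → summand i (insertAt y i t))      ≡⟨ rangeSum-cong B summand-at ⟩
        rangeSum B (λ t → P * L t)                         ≡⟨ rangeSum-*ˡ B P L ⟩
        P * rangeSum B L                                   ≡⟨ P*-cong ⟩
        P * rangeSum B R                                   ≡⟨ rangeSum-*ˡ B P R ⟨
        rangeSum B (λ t → P * R t)                         ≡⟨ rangeSum-cong B substituted-at ⟨
        rangeSum B (λ t → substituted i (insertAt y i t))  ∎
        where
        open ≡-Reasoning
        P*-cong : P * rangeSum B L ≡ P * rangeSum B R
        P*-cong with P ≟ + 0
        ... | yes P≡0 = trans (cong (_* rangeSum B L) P≡0) (sym (cong (_* rangeSum B R) P≡0))
        ... | no  P≢0 = cong (P *_) (substitution-applies P≢0)

    W-dVec≡boxSum : ∀ i → W (+ N i) (toList (dVec d δ i)) ≡ boxSum B m (substituted i)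
    W-dVec≡boxSum i = begin
      W (+ N i) (toList (dVec d δ i))
        ≡⟨ W-boxSum B m (dVec d δ i) (dVec≢0 i) (+ N i) (+≤+ (N≤B i)) ⟩
      boxSum B m (summand i)
        ≡⟨ boxSum-insertAt B m′ i (summand i) ⟩
      boxSum B m′ (λ y → rangeSum B (λ t → summand i (insertAt y i t)))
        ≡⟨ boxSum-cong B m′ (Slice.slice i) ⟩
      boxSum B m′ (λ y → rangeSum B (λ t → substituted i (insertAt y i t)))
        ≡⟨ boxSum-insertAt B m′ i (substituted i) ⟨
      boxSum B m (substituted i) ∎
      where open ≡-Reasoning

    module Collapse (x : Vec ℤ m) where

      A Q Hσ : ℤ
      A  = ∏ (λ j → heaviside (lookup x j))
      Q  = ∏ (λ j → heaviside (lookup x j) - + 1)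
      Hσ = heaviside (+ σ + dot δℤ x)

      Q≡0 : dot dℤ x ≡ + s → Q ≡ + 0
      Q≡0 dot≡s with Fin.any? (λ j → + 0 ≤? lookup x j)
      ... | yes (j , 0≤xⱼ) = ∏-≡0 j (cong (_- + 1) (heaviside-nonneg 0≤xⱼ))
      ... | no  ∄0≤xⱼ     = contradiction (subst (_< + 0) dot≡s dot<0) (λ { (+<+ ()) })
        where
        +a*t<0 : ∀ {a t} → a ℕ.> 0 → t < + 0 → + a * t < + 0
        +a*t<0 {suc _} { -[1+ _ ]} _  _        = -<+
        +a*t<0 {zero}  { -[1+ _ ]} () _
        +a*t<0 {t = + _}           _  (+<+ ())
        dot<0 : dot dℤ x < + 0
        dot<0 = ∑-neg _ (λ j → +a*t<0 (d>0 j) (≰⇒> (λ 0≤xⱼ → ∄0≤xⱼ (j , 0≤xⱼ))))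

      Hσ*A≡A : Hσ * A ≡ A
      Hσ*A≡A with Fin.any? (λ j → lookup x j <? + 0)
      ... | yes (j , xⱼ<0) = trans (cong (Hσ *_) A≡0) (trans (*-zeroʳ Hσ) (sym A≡0))
        where
        A≡0 : A ≡ + 0
        A≡0 = ∏-≡0 j (heaviside-neg xⱼ<0)
      ... | no  ∄xⱼ<0     = trans (cong (_* A) (heaviside-nonneg 0≤σ+δx)) (*-identityˡ A)
        where
        0≤+a*t : ∀ {a t} → + 0 ≤ t → + 0 ≤ + a * t
        0≤+a*t {a} {+ n} _ = subst (+ 0 ≤_) (pos-* a n) (+≤+ z≤n)
        0≤σ+δx : + 0 ≤ + σ + dot δℤ x
        0≤σ+δx = +-mono-≤ (+≤+ z≤n) (∑-nonneg _ (λ j → 0≤+a*t {δ j} (≮⇒≥ (∄xⱼ<0 ∘ (j ,_)))))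

      collapse : dot dℤ x ≡ + s → Hσ * (A - Q) ≡ A
      collapse dot≡s = begin
        Hσ * (A - Q)    ≡⟨ cong (λ q → Hσ * (A - q)) (Q≡0 dot≡s) ⟩
        Hσ * (A - + 0)  ≡⟨ cong (Hσ *_) (+-identityʳ A) ⟩
        Hσ * A          ≡⟨ Hσ*A≡A ⟩
        A               ∎
        where open ≡-Reasoning

    ∑-substituted : ∀ x → ∑ (λ i → substituted i x) ≡ 𝟙[ dot dℤ x ≡ + s ] * weightProd dℤ x
    ∑-substituted x = begin
      ∑ (λ i → I * Hσ * ∏ (F i))  ≡⟨ *-distribˡ-∑ (I * Hσ) (λ i → ∏ (F i)) ⟨
      I * Hσ * ∑ (λ i → ∏ (F i))  ≡⟨ cong (I * Hσ *_) telescoped ⟩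
      I * Hσ * (A - Q)            ≡⟨ *-assoc I Hσ (A - Q) ⟩
      I * (Hσ * (A - Q))          ≡⟨ 𝟙-*-cong collapse ⟩
      I * A                       ∎
      where
      open ≡-Reasoning
      open Collapse x
      I : ℤ
      I = 𝟙[ dot dℤ x ≡ + s ]
      F : Fin m → Fin m → ℤ
      F i j = rowWeight d δ i j (lookup x j)
      telescoped : ∑ (λ i → ∏ (F i)) ≡ A - Q
      telescoped = telescope (_≺_ d δ) (≺-connex d δ distinct) (≺-trans d δ) (λ j → heaviside (lookup x j)) F
                             (λ i → rowWeight-diag d δ i _) (rowWeight-≺ d δ _) (rowWeight-≻ d δ _)

    identity : + Wpos s (toList d) ≡ sumFin (λ i → W (+ N i) (toList (dVec d δ i)))
    identity = begin
      + Wpos s (toList d)                                      ≡⟨ W-+ s d ⟨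
      W (+ s) (toList dℤ)                                      ≡⟨ W-boxSum B m dℤ dℤ≢0 (+ s) (+≤+ s≤B) ⟩
      boxSum B m (λ x → 𝟙[ dot dℤ x ≡ + s ] * weightProd dℤ x) ≡⟨ boxSum-cong B m ∑-substituted ⟨
      boxSum B m (λ x → ∑ (λ i → substituted i x))             ≡⟨ ∑-boxSum-comm B m substituted ⟨
      ∑ (λ i → boxSum B m (substituted i))                     ≡⟨ ∑-cong W-dVec≡boxSum ⟨
      ∑ (λ i → W (+ N i) (toList (dVec d δ i)))                ≡⟨ sumFin≡∑ _ ⟨
      sumFin (λ i → W (+ N i) (toList (dVec d δ i)))           ∎
      where
      open ≡-Reasoning
      dℤ≢0 : ∀ j → dℤ j ≢ + 0
      dℤ≢0 j = ℕ.>⇒≢ (d>0 j) ∘ +-injective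

open import Defs
open import Data.Nat using (ℕ; _+_; _*_; _≥_; _>_)
open import Data.Nat.GCD using (gcd)
open import Data.Integer using (+_)
open import Data.Fin using (Fin)
open import Data.Vec.Functional using (toList)
open import Relation.Binary.PropositionalEquality using (_≡_; _≢_)
open import Data.Nat using (suc)

mainTheorem1 : (m : ℕ) → m ≥ 1 → (d δ : Fin m → ℕ) →
    (∀ i → d i > 0) → (∀ i → δ i > 0) → (∀ i → gcd (δ i) (d i) ≡ 1) →
    (∀ i j → i ≢ j → δ i * d j ≢ δ j * d i) →
    (σ s : ℕ) →
    + Wpos s (toList d) ≡ sumFin (λ i → W (+ (s * δ i + σ * d i)) (toList (dVec d δ i)))
mainTheorem1 (suc m′) _ d δ d>0 _ coprime distinct σ s = Proof.Identity.identity d δ d>0 coprime distinct σ s
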